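{- Let $S'$ be a set of $k$ positive integers and let $x_0,x_1\in S'$ with $x_0\neq x_1$. For each subset $P\subseteq S'$, define its aliased sum as the sum of the elements of $P$, except that $x_1$, if it belongs to $P$, contributes the value $x_0$ instead of $x_1$. Then the number of distinct aliased sums, taken over all $2^k$ subsets $P\subseteq S'$, is at most $\tfrac34\cdot 2^k$. -}

module Defs where

open import Data.Nat using (ℕ; zero; suc; _+_)
open import Data.Fin using (Fin; zero; suc)
open import Data.Vec using (Vec; []; _∷_; lookup; _[_]≔_)
open import Data.List using (List; []; _∷_; map; _++_; deduplicate; length)
open import Data.Fin.Subset using (Subset; Side; inside; outside)
open import Data.Nat.Properties using (_≟_)

-- The finite set S' = {s₀,…,s_{k-1}} is given as a vector s : Vec ℕ k
-- (pairwise distinct positive entries, imposed in the statement).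

allSubsets : (k : ℕ) → List (Subset k)
allSubsets zero = [] ∷ []
allSubsets (suc k) = map (inside ∷_) (allSubsets k) ++ map (outside ∷_) (allSubsets k)

subsetSum : ∀ {k} → Vec ℕ k → Subset k → ℕ
subsetSum [] [] = 0
subsetSum (x ∷ v) (inside ∷ p) = x + subsetSum v p
subsetSum (x ∷ v) (outside ∷ p) = subsetSum v p

-- Aliased sum with x₀ = s[i], x₁ = s[j]: the element x₁ contributes x₀.
aliasedSum : ∀ {k} → Vec ℕ k → Fin k → Fin k → Subset k → ℕ
aliasedSum s i j P = subsetSum (s [ j ]≔ lookup s i) P

numAliasedSums : ∀ {k} → Vec ℕ k → Fin k → Fin k → ℕ
numAliasedSums {k} s i j = length (deduplicate _≟_ (map (aliasedSum s i j) (allSubsets k)))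

{-# OPTIONS --safe #-}
module Submission where

-- Put a = s[i]. In the aliased vector s[j] ≔ a the positions i and j both carry a,
-- so the aliased sum of P is c + σ, where c ∈ {0, a, 2a} only records how many of
-- i, j lie in P and σ is a subset sum of the other k − 2 entries. Hence there are
-- at most 3 · 2^(k−2) aliased sums; positivity and distinctness of the entries are
-- not needed.

open import Defs
open import Data.Nat using (ℕ; _*_; _^_; _≤_; _<_; zero; suc; _+_)
open import Data.Nat.Properties using (_≟_; +-assoc; +-comm; +-identityʳ; *-monoʳ-≤; module ≤-Reasoning)
open import Data.Nat.Tactic.RingSolver using (solve-∀)
open import Data.Fin using (Fin; zero; suc; punchOut)
open import Data.Fin.Properties using (injective⇒≤)
open import Data.Vec using (Vec; lookup; []; _∷_; removeAt; _[_]≔_)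
open import Data.Vec.Properties using (removeAt-punchOut; lookup∘update; lookup∘update′)
open import Data.Vec.Relation.Unary.All using (All)
open import Data.Vec.Relation.Unary.Unique.Propositional using (Unique)
open import Data.List as List using (List; map; _++_; deduplicate; length)
open import Data.List.Membership.Propositional using (_∈_)
open import Data.List.Relation.Binary.Subset.Propositional using (_⊆_)
open import Data.List.Membership.Propositional.Properties using (∈-lookup; ∈-map⁺; ∈-map⁻; ∈-++⁺ˡ; ∈-++⁺ʳ; ∈-deduplicate⁻)
import Data.List.Membership.Setoid.Properties as Membershipₛ
open import Data.List.Relation.Unary.Any using (here)
import Data.List.Relation.Unary.All as ListAll
import Data.List.Relation.Unary.Unique.Propositional as List
open import Data.List.Relation.Unary.Unique.DecPropositional.Properties using (deduplicate-!)
open import Data.List.Relation.Unary.AllPairs using (_∷_)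
open import Data.List.Properties using (length-map; length-++)
open import Data.Fin.Subset using (Subset; Side; inside; outside)
open import Data.Product using (_,_)
open import Function using (_∘_)
open import Function.Definitions using (Injective)
open import Relation.Binary.PropositionalEquality
  using (_≡_; _≢_; refl; sym; trans; cong; cong₂; subst; setoid; module ≡-Reasoning)
open import Relation.Binary.Definitions using (DecidableEquality)
open import Relation.Nullary using (contradiction)

private
  variable
    A : Set
    xs ys : List A

Unique⇒lookup-injective : List.Unique xs → Injective _≡_ _≡_ (List.lookup xs)
Unique⇒lookup-injective (_ ∷ _)     {zero}  {zero}  _  = refl
Unique⇒lookup-injective (x∉xs ∷ _)  {zero}  {suc q} eq = contradiction eq (ListAll.lookup x∉xs (∈-lookup q))
Unique⇒lookup-injective (x∉xs ∷ _)  {suc p} {zero}  eq = contradiction (sym eq) (ListAll.lookup x∉xs (∈-lookup p))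
Unique⇒lookup-injective (_ ∷ !xs)   {suc p} {suc q} eq = cong suc (Unique⇒lookup-injective !xs eq)

-- Sending each position of xs to the position of its copy in ys is injective.
Unique-⊆⇒length≤ : List.Unique xs → xs ⊆ ys → length xs ≤ length ys
Unique-⊆⇒length≤ !xs xs⊆ys = injective⇒≤ λ eq →
  Unique⇒lookup-injective !xs (Membershipₛ.index-injective (setoid _) (xs⊆ys (∈-lookup _)) (xs⊆ys (∈-lookup _)) eq)

length-deduplicate-≤ : (_≟_ : DecidableEquality A) → xs ⊆ ys → length (deduplicate _≟_ xs) ≤ length ys
length-deduplicate-≤ {xs = xs} _≟_ xs⊆ys = Unique-⊆⇒length≤ (deduplicate-! _≟_ xs) (xs⊆ys ∘ ∈-deduplicate⁻ _≟_ xs)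

contribution : Side → ℕ → ℕ
contribution inside  x = x
contribution outside _ = 0

subsetSum-removeAt : ∀ {n} (t : Vec ℕ (suc n)) (P : Subset (suc n)) (i : Fin (suc n)) →
  subsetSum t P ≡ contribution (lookup P i) (lookup t i) + subsetSum (removeAt t i) (removeAt P i)
subsetSum-removeAt (x ∷ t)     (inside ∷ P)      zero    = refl
subsetSum-removeAt (x ∷ t)     (outside ∷ P)     zero    = refl
subsetSum-removeAt (x ∷ y ∷ t) (outside ∷ b ∷ P) (suc i) = subsetSum-removeAt (y ∷ t) (b ∷ P) i
subsetSum-removeAt (x ∷ y ∷ t) (inside ∷ b ∷ P)  (suc i) = begin
  x + subsetSum (y ∷ t) (b ∷ P)    ≡⟨ cong (x +_) (subsetSum-removeAt (y ∷ t) (b ∷ P) i) ⟩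
  x + (c + σ)                      ≡⟨ sym (+-assoc x c σ) ⟩
  x + c + σ                        ≡⟨ cong (_+ σ) (+-comm x c) ⟩
  c + x + σ                        ≡⟨ +-assoc c x σ ⟩
  c + (x + σ)                      ∎
  where
  open ≡-Reasoning
  c = contribution (lookup (b ∷ P) i) (lookup (y ∷ t) i)
  σ = subsetSum (removeAt (y ∷ t) i) (removeAt (b ∷ P) i)

∈-allSubsets : ∀ {n} (P : Subset n) → P ∈ allSubsets n
∈-allSubsets         []            = here refl
∈-allSubsets {suc n} (inside ∷ P)  = ∈-++⁺ˡ (∈-map⁺ (inside ∷_) (∈-allSubsets P))
∈-allSubsets {suc n} (outside ∷ P) = ∈-++⁺ʳ (map (inside ∷_) (allSubsets n)) (∈-map⁺ (outside ∷_) (∈-allSubsets P))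

length-allSubsets : ∀ n → length (allSubsets n) ≡ 2 ^ n
length-allSubsets zero    = refl
length-allSubsets (suc n) = begin
  length (map (inside ∷_) Ps ++ map (outside ∷_) Ps)        ≡⟨ length-++ (map (inside ∷_) Ps) ⟩
  length (map (inside ∷_) Ps) + length (map (outside ∷_) Ps) ≡⟨ cong₂ _+_ (length-map _ Ps) (length-map _ Ps) ⟩
  length Ps + length Ps                                      ≡⟨ cong (λ m → m + m) (length-allSubsets n) ⟩
  2 ^ n + 2 ^ n                                              ≡⟨ cong (2 ^ n +_) (sym (+-identityʳ (2 ^ n))) ⟩
  2 * 2 ^ n                                                  ∎
  where
  open ≡-Reasoning
  Ps = allSubsets n

shifts : ℕ → List ℕ → List ℕ
shifts a σs = σs ++ map (a +_) σs ++ map (λ σ → a + (a + σ)) σs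

length-shifts : ∀ a σs → length (shifts a σs) ≡ 3 * length σs
length-shifts a σs = begin
  length (σs ++ map (a +_) σs ++ map (λ σ → a + (a + σ)) σs)
    ≡⟨ length-++ σs ⟩
  length σs + length (map (a +_) σs ++ map (λ σ → a + (a + σ)) σs)
    ≡⟨ cong (length σs +_) (length-++ (map (a +_) σs)) ⟩
  length σs + (length (map (a +_) σs) + length (map (λ σ → a + (a + σ)) σs))
    ≡⟨ cong (length σs +_) (cong₂ _+_ (length-map _ σs) (length-map _ σs)) ⟩
  length σs + (length σs + length σs)
    ≡⟨ cong (λ m → length σs + (length σs + m)) (sym (+-identityʳ (length σs))) ⟩
  3 * length σs
    ∎
  where open ≡-Reasoning

∈-shifts : ∀ {a σ σs} → σ ∈ σs → (b c : Side) → contribution b a + (contribution c a + σ) ∈ shifts a σs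
∈-shifts               σ∈σs outside outside = ∈-++⁺ˡ σ∈σs
∈-shifts     {σs = σs} σ∈σs inside  outside = ∈-++⁺ʳ σs (∈-++⁺ˡ (∈-map⁺ _ σ∈σs))
∈-shifts     {σs = σs} σ∈σs outside inside  = ∈-++⁺ʳ σs (∈-++⁺ˡ (∈-map⁺ _ σ∈σs))
∈-shifts {a} {σs = σs} σ∈σs inside  inside  = ∈-++⁺ʳ σs (∈-++⁺ʳ (map (a +_) σs) (∈-map⁺ _ σ∈σs))

subsetSum-∈-shifts : ∀ {n a} (t : Vec ℕ (suc (suc n))) {i j} (i≢j : i ≢ j) →
  lookup t i ≡ a → lookup t j ≡ a → (P : Subset (suc (suc n))) →
  subsetSum t P ∈ shifts a (map (subsetSum (removeAt (removeAt t i) (punchOut i≢j))) (allSubsets n))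
subsetSum-∈-shifts {n} {a} t {i} i≢j tᵢ≡a tⱼ≡a P =
  subst (_∈ shifts a (map (subsetSum u) (allSubsets n))) (sym sum≡)
    (∈-shifts (∈-map⁺ (subsetSum u) (∈-allSubsets Q)) (lookup P i) (lookup P₁ j′))
  where
  open ≡-Reasoning
  j′ = punchOut i≢j
  t₁ = removeAt t i
  P₁ = removeAt P i
  u = removeAt t₁ j′
  Q = removeAt P₁ j′
  sum≡ : subsetSum t P ≡ contribution (lookup P i) a + (contribution (lookup P₁ j′) a + subsetSum u Q)
  sum≡ = begin
    subsetSum t P
      ≡⟨ subsetSum-removeAt t P i ⟩
    contribution (lookup P i) (lookup t i) + subsetSum t₁ P₁
      ≡⟨ cong₂ (λ x y → contribution (lookup P i) x + y) tᵢ≡a (subsetSum-removeAt t₁ P₁ j′) ⟩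
    contribution (lookup P i) a + (contribution (lookup P₁ j′) (lookup t₁ j′) + subsetSum u Q)
      ≡⟨ cong (λ x → contribution (lookup P i) a + (contribution (lookup P₁ j′) x + subsetSum u Q))
              (trans (removeAt-punchOut t i≢j) tⱼ≡a) ⟩
    contribution (lookup P i) a + (contribution (lookup P₁ j′) a + subsetSum u Q)
      ∎

numAliasedSums-≤ : ∀ {n} (s : Vec ℕ (suc (suc n))) {i j} → i ≢ j → numAliasedSums s i j ≤ 3 * 2 ^ n
numAliasedSums-≤ {n} s {i} {j} i≢j = begin
  length (deduplicate _≟_ (map (aliasedSum s i j) (allSubsets (suc (suc n)))))
    ≤⟨ length-deduplicate-≤ _≟_ aliasedSums⊆shifts ⟩
  length (shifts a σs)   ≡⟨ length-shifts a σs ⟩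
  3 * length σs          ≡⟨ cong (3 *_) (trans (length-map _ (allSubsets n)) (length-allSubsets n)) ⟩
  3 * 2 ^ n              ∎
  where
  open ≤-Reasoning
  a = lookup s i
  t = s [ j ]≔ a
  σs = map (subsetSum (removeAt (removeAt t i) (punchOut i≢j))) (allSubsets n)
  aliasedSums⊆shifts : map (aliasedSum s i j) (allSubsets (suc (suc n))) ⊆ shifts a σs
  aliasedSums⊆shifts x∈ with P , _ , refl ← ∈-map⁻ (aliasedSum s i j) x∈ =
    subsetSum-∈-shifts t i≢j (lookup∘update′ i≢j s a) (lookup∘update j s a) P

lemma6 : (k : ℕ) (s : Vec ℕ k) → All (λ x → 0 < x) s → Unique s →
    (i j : Fin k) → i ≢ j →
    4 * numAliasedSums s i j ≤ 3 * 2 ^ k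
lemma6 (suc zero)    s _ _ zero zero i≢j = contradiction refl i≢j
lemma6 (suc (suc n)) s _ _ i    j    i≢j = begin
  4 * numAliasedSums s i j  ≤⟨ *-monoʳ-≤ 4 (numAliasedSums-≤ s i≢j) ⟩
  4 * (3 * 2 ^ n)           ≡⟨ rearrange (2 ^ n) ⟩
  3 * 2 ^ suc (suc n)       ∎
  where
  open ≤-Reasoning
  rearrange : ∀ m → 4 * (3 * m) ≡ 3 * (2 * (2 * m))
  rearrange = solve-∀
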